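{- Let $\mathcal{G}=(X,\mathcal{F},P)$ be a Maker-Breaker poset positional game where $P$ is made of pairwise disjoint chains, and suppose $\{x_{i,j}\}\in\mathcal{F}$ for some black vertex $x_{i,j}$ with $j\geq 3$ that is not minimal in $P$. Suppose $|X|$ is even, let $Y=\{x_{i,1},\dots,x_{i,j-1}\}$, $X'=X\setminus Y$, $P'$ the poset induced by $P$ on $X'$, and let $\mathcal{F}'$ consist of: every $S\in\mathcal{F}$ with $S\subseteq X'$, and $S\cap X'$ for every $S\in\mathcal{F}$ with $S\cap Y\neq\emptyset$ such that all elements of $S\cap Y$ are white. Let $\mathcal{G}'=(X',\mathcal{F}',P')$. If Maker has a winning strategy in $\mathcal{G}'$ (Maker starting), then she has a winning strategy in $\mathcal{G}'$ in which she never claims $x_{i,j+1}$ unless that claim makes her win immediately.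
   Context: A poset positional game is a triple $(X,\mathcal{F},P)$ with $X$ a finite board of vertices, $\mathcal{F}\subseteq 2^X$ the winning sets, and $P$ a partial order on $X$. Two players alternately claim an unclaimed vertex $v$ such that all vertices smaller than $v$ in $P$ are already claimed, until all vertices are claimed. In the Maker-Breaker convention, Maker wins if she claims all vertices of some winning set; otherwise Breaker wins. $P$ is made of pairwise disjoint chains $C_1,\dots,C_w$ (partitioning $X$, elements of distinct chains incomparable); the elements of $C_i$ are written $x_{i,1}>x_{i,2}>\dots>x_{i,\ell_i}$ (numbered from top to bottom). The vertex $x_{i,j}$ is colored white if $j$ has the same parity as $|X|$, and black otherwise. -}

module Defs where

open import Data.Nat using (ℕ; zero; suc; _≤_; _<_; _%_; _∸_; _≤?_; _<?_)
open import Data.Nat.ListAction using (sum)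
open import Data.Fin using (Fin) renaming (_≟_ to _≟ᶠ_)
open import Data.Product using (Σ; ∃; _×_; _,_)
open import Data.Sum using (_⊎_)
open import Data.List using (List; []; _∷_; _∷ʳ_; length; map; filter; _++_; allFin)
open import Data.List.Membership.Propositional using (_∈_; _∉_)
open import Data.List.Relation.Unary.All as All using (All)
open import Data.List.Relation.Unary.Any as Any using (Any)
open import Relation.Binary.PropositionalEquality using (_≡_; _≢_)
open import Relation.Nullary using (¬_; Dec)
open import Relation.Nullary.Decidable using (_×-dec_; _→-dec_; ¬?)
open import Level using (Level; suc; zero)

-- A game on vertices of type V: the board X (as a predicate on V),
-- the strict order of the poset P restricted to the board, and the
-- list of winning sets (each list read as the set of its elements).
record Game (V : Set) : Set₁ where
  field
    Board : V → Set
    _≺_   : V → V → Set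
    Win   : List (List V)

open Game public

-- Histories are chronological lists of claimed vertices; Maker claims
-- the vertices at (0-based) even positions, since Maker starts.
makerPart : {V : Set} → List V → List V
makerPart []            = []
makerPart (x ∷ [])      = x ∷ []
makerPart (x ∷ _ ∷ xs)  = x ∷ makerPart xs

Legal : {V : Set} → Game V → List V → V → Set
Legal G h v = Board G v × v ∉ h × (∀ u → Board G u → _≺_ G u v → u ∈ h)

Complete : {V : Set} → Game V → List V → Set
Complete G h = ∀ v → Board G v → v ∈ h

MakerOwnsWinSet : {V : Set} → Game V → List V → Set
MakerOwnsWinSet G M = Any (λ S → All (_∈ M) S) (Win G)

MakerWon : {V : Set} → Game V → List V → Set
MakerWon G h = MakerOwnsWinSet G (makerPart h)

Strategy : Set → Set
Strategy V = List V → V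

data Reach {V : Set} (G : Game V) (σ : Strategy V) : List V → Set where
  start   : Reach G σ []
  maker   : ∀ {h} → Reach G σ h → length h % 2 ≡ 0 →
            Legal G h (σ h) → Reach G σ (h ∷ʳ σ h)
  breaker : ∀ {h v} → Reach G σ h → length h % 2 ≡ 1 →
            Legal G h v → Reach G σ (h ∷ʳ v)

WinningStrategy : {V : Set} → Game V → Strategy V → Set
WinningStrategy G σ =
  (∀ h → Reach G σ h → length h % 2 ≡ 0 → ¬ Complete G h → Legal G h (σ h))
  × (∀ h → Reach G σ h → Complete G h → MakerWon G h)

MakerWins : {V : Set} → Game V → Set
MakerWins {V} G = Σ (Strategy V) (WinningStrategy G)

NeverClaimsUnlessWin : {V : Set} → Game V → Strategy V → V → Set
NeverClaimsUnlessWin G σ x =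
  ∀ h → Reach G σ h → length h % 2 ≡ 0 → ¬ Complete G h → σ h ≡ x →
  MakerOwnsWinSet G (makerPart h ∷ʳ x)

IsMinimal : {V : Set} → Game V → V → Set
IsMinimal G x = ∀ u → Board G u → ¬ (_≺_ G u x)

SameSet : {V : Set} → List V → List V → Set
SameSet S T = (∀ v → v ∈ S → v ∈ T) × (∀ v → v ∈ T → v ∈ S)

-- Chains C_0 … C_{w-1}; chain i has length ℓ i.  The vertex x_{i,j}
-- (1 ≤ j ≤ ℓ i, numbered from top to bottom) is the pair (i , j).
Vtx : ℕ → Set
Vtx w = Fin w × ℕ

module Chains {w : ℕ} (ℓ : Fin w → ℕ) where

  OnX : Vtx w → Set
  OnX (i , j) = 1 ≤ j × j ≤ ℓ i

  _<P_ : Vtx w → Vtx w → Set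
  (i , j) <P (i' , j') = i ≡ i' × j' < j

  size : ℕ
  size = sum (map ℓ (allFin w))

  White : Vtx w → Set
  White (i , j) = j % 2 ≡ size % 2

  Black : Vtx w → Set
  Black (i , j) = j % 2 ≢ size % 2

  white? : ∀ v → Dec (White v)
  white? (i , j) = Data.Nat._≟_ (j % 2) (size % 2)

  chainGame : List (List (Vtx w)) → Game (Vtx w)
  chainGame F = record { Board = OnX ; _≺_ = _<P_ ; Win = F }

  module Reduced (F : List (List (Vtx w))) (i : Fin w) (j : ℕ) where

    InY : Vtx w → Set
    InY (i' , j') = i' ≡ i × 1 ≤ j' × j' < j

    inY? : ∀ v → Dec (InY v)
    inY? (i' , j') = (i' ≟ᶠ i) ×-dec ((1 ≤? j') ×-dec (j' <? j))

    OnX' : Vtx w → Set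
    OnX' v = OnX v × ¬ InY v

    _<P'_ : Vtx w → Vtx w → Set
    u <P' v = OnX' u × OnX' v × u <P v

    F' : List (List (Vtx w))
    F' = filter (λ S → All.all? (λ v → ¬? (inY? v)) S) F
         ++ map (filter (λ v → ¬? (inY? v)))
                (filter (λ S → Any.any? inY? S
                               ×-dec All.all? (λ v → inY? v →-dec white? v) S) F)

    G' : Game (Vtx w)
    G' = record { Board = OnX' ; _≺_ = _<P'_ ; Win = F' }

-- Maker runs her winning strategy σ for G' on a virtual board.  Whenever σ asks
-- for y = x_{i,j+1}, the virtual play lets Maker take y and Breaker answer with
-- x = x_{i,j}, and σ is consulted again; on the real board x and y stay free.
-- As x is maximal in P', lies above nothing but y and what lies below y, and is
-- the only vertex above y, Breaker can enter {x, y} only by taking y; Maker then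
-- takes x and wins, since {x} ∈ F'.  Otherwise the virtual play ends first, and
-- as Maker's virtual vertices are her real ones plus y, claiming y wins.
module Submission where

open import Defs
open import Data.Nat using (ℕ; zero; suc; _≤_; _<_; _%_; z≤n; s≤s; _≤?_)
import Data.Nat as ℕ
open import Data.Nat.DivMod using (%-distribˡ-+; %-remove-+ˡ; m%n<n)
open import Data.Nat.Divisibility using (∣-refl)
open import Data.Nat.Properties using (≤-refl; ≤-trans; n≤1+n; <⇒≱; m≤n⇒m<n∨m≡n; m<1+n⇒m<n∨m≡n; <-irrefl)
open import Data.Fin using (Fin)
import Data.Fin as Fin
open import Data.Fin.Properties using (any?)
open import Data.Product using (Σ; _×_; _,_; proj₁; proj₂)
open import Data.Product.Properties using (≡-dec)
open import Data.Sum using (_⊎_; inj₁; inj₂; [_,_]′)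
open import Data.Empty using (⊥-elim)
open import Data.List using (List; _∷_; []; [_]; _∷ʳ_; length; foldl)
open import Data.List.Properties using (foldl-∷ʳ)
open import Data.List.Relation.Unary.All as All using (All)
open import Data.List.Relation.Unary.Any as Any using (Any; here; there)
open import Data.List.Relation.Unary.Any.Properties using (++⁺ˡ)
open import Data.List.Membership.Propositional using (_∈_; _∉_; find; lose)
open import Data.List.Membership.Propositional.Properties using (∈-++⁺ˡ; ∈-++⁺ʳ; ∈-++⁻; ∈-filter⁺)
import Data.List.Membership.DecPropositional as DecMembership
open import Data.List.Relation.Binary.Subset.Propositional using (_⊆_)
import Data.List.Relation.Binary.Subset.Propositional.Properties as ⊆
open import Function using (_∘_)
open import Relation.Binary.Definitions using (DecidableEquality)
open import Relation.Binary.PropositionalEquality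
  using (_≡_; _≢_; refl; sym; trans; cong; subst; module ≡-Reasoning)
open import Relation.Nullary using (¬_; Dec; yes; no)
open import Relation.Nullary.Decidable using (_×-dec_; ¬?)
open import Relation.Unary using (Decidable)

module _ {A : Set} where

  ∈-∷ʳ⁻ : ∀ {v u : A} h → v ∈ h ∷ʳ u → v ∈ h ⊎ v ≡ u
  ∈-∷ʳ⁻ h v∈ with ∈-++⁻ h v∈
  ... | inj₁ v∈h         = inj₁ v∈h
  ... | inj₂ (here v≡u) = inj₂ v≡u

  ∈-∷ʳ-last : ∀ (h : List A) {u} → u ∈ h ∷ʳ u
  ∈-∷ʳ-last h = ∈-++⁺ʳ h (here refl)

  ∉-∷ʳ : ∀ {v u : A} {h} → v ∉ h → v ≢ u → v ∉ h ∷ʳ u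
  ∉-∷ʳ {h = h} v∉h v≢u v∈ = [ v∉h , v≢u ]′ (∈-∷ʳ⁻ h v∈)

  ∷⊆∷ʳ : ∀ {u : A} h → u ∷ h ⊆ h ∷ʳ u
  ∷⊆∷ʳ h (here refl) = ∈-∷ʳ-last h
  ∷⊆∷ʳ h (there v∈h) = ∈-++⁺ˡ v∈h

  ∷ʳ-⊆ : ∀ {u : A} {h h′} → h ⊆ h′ → u ∈ h′ → h ∷ʳ u ⊆ h′
  ∷ʳ-⊆ {h = h} h⊆h′ u∈h′ v∈ = [ h⊆h′ , (λ { refl → u∈h′ }) ]′ (∈-∷ʳ⁻ h v∈)

  length-∷ʳ : ∀ (h : List A) u → length (h ∷ʳ u) ≡ suc (length h)
  length-∷ʳ []      u = refl
  length-∷ʳ (_ ∷ h) u = cong suc (length-∷ʳ h u)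

even-or-odd : ∀ n → n % 2 ≡ 0 ⊎ n % 2 ≡ 1
even-or-odd n with n % 2 | m%n<n n 2
... | 0           | _                = inj₁ refl
... | 1           | _                = inj₂ refl
... | suc (suc _) | s≤s (s≤s ())

even≢odd : ∀ n → n % 2 ≡ 0 → n % 2 ≢ 1
even≢odd _ ev od with trans (sym ev) od
... | ()

suc-%2-cong : ∀ m n → m % 2 ≡ n % 2 → suc m % 2 ≡ suc n % 2
suc-%2-cong m n eq = begin
  suc m % 2        ≡⟨ %-distribˡ-+ 1 m 2 ⟩
  suc (m % 2) % 2  ≡⟨ cong (λ r → suc r % 2) eq ⟩
  suc (n % 2) % 2  ≡⟨ %-distribˡ-+ 1 n 2 ⟨
  suc n % 2        ∎
  where open ≡-Reasoning

module _ {A : Set} where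

  turn-∷ʳ : ∀ n (h : List A) u → length h % 2 ≡ n % 2 → length (h ∷ʳ u) % 2 ≡ suc n % 2
  turn-∷ʳ n h u eq = trans (cong (_% 2) (length-∷ʳ h u)) (suc-%2-cong (length h) n eq)

  even-∷ʳ : ∀ (h : List A) u → length h % 2 ≡ 0 → length (h ∷ʳ u) % 2 ≡ 1
  even-∷ʳ = turn-∷ʳ 0

  odd-∷ʳ : ∀ (h : List A) u → length h % 2 ≡ 1 → length (h ∷ʳ u) % 2 ≡ 0
  odd-∷ʳ = turn-∷ʳ 1

  sameTurn-∷ʳ : ∀ (h h′ : List A) u u′ → length h % 2 ≡ length h′ % 2 →
                length (h ∷ʳ u) % 2 ≡ length (h′ ∷ʳ u′) % 2
  sameTurn-∷ʳ h h′ u u′ eq =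
    trans (turn-∷ʳ (length h′) h u eq) (sym (turn-∷ʳ (length h′) h′ u′ refl))

  sameTurn-∷ʳ∷ʳ : ∀ (h : List A) u v → length (h ∷ʳ u ∷ʳ v) % 2 ≡ length h % 2
  sameTurn-∷ʳ∷ʳ h u v =
    trans (turn-∷ʳ (suc (length h)) (h ∷ʳ u) v (turn-∷ʳ (length h) h u refl))
          (%-remove-+ˡ (length h) ∣-refl)

  makerPart-∷ʳ-even : ∀ (h : List A) u → length h % 2 ≡ 0 → makerPart (h ∷ʳ u) ≡ makerPart h ∷ʳ u
  makerPart-∷ʳ-even []          u _  = refl
  makerPart-∷ʳ-even (_ ∷ [])    u ()
  makerPart-∷ʳ-even (a ∷ b ∷ h) u ev = cong (a ∷_) (makerPart-∷ʳ-even h u ev)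

  makerPart-∷ʳ-odd : ∀ (h : List A) u → length h % 2 ≡ 1 → makerPart (h ∷ʳ u) ≡ makerPart h
  makerPart-∷ʳ-odd []          u ()
  makerPart-∷ʳ-odd (_ ∷ [])    u _  = refl
  makerPart-∷ʳ-odd (a ∷ b ∷ h) u od = cong (a ∷_) (makerPart-∷ʳ-odd h u od)

  makerPart-⊆-∷ʳ : ∀ (h : List A) u → makerPart h ⊆ makerPart (h ∷ʳ u)
  makerPart-⊆-∷ʳ []          u ()
  makerPart-⊆-∷ʳ (_ ∷ [])    u a∈ = a∈
  makerPart-⊆-∷ʳ (a ∷ b ∷ h) u = ⊆.∷⁺ʳ a (makerPart-⊆-∷ʳ h u)

module _ {V : Set} {G : Game V} where

  ownsWinSet-mono : ∀ {M M′} → M ⊆ M′ → MakerOwnsWinSet G M → MakerOwnsWinSet G M′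
  ownsWinSet-mono M⊆M′ = Any.map (All.map M⊆M′)

  DownClosed : List V → Set
  DownClosed h = ∀ {u v} → v ∈ h → Board G u → _≺_ G u v → u ∈ h

  downClosed-∷ʳ : ∀ {h m} → DownClosed h → Legal G h m → DownClosed (h ∷ʳ m)
  downClosed-∷ʳ {h} closed (_ , _ , below) v∈ u∈X u≺v with ∈-∷ʳ⁻ h v∈
  ... | inj₁ v∈h  = ∈-++⁺ˡ (closed v∈h u∈X u≺v)
  ... | inj₂ refl = ∈-++⁺ˡ (below _ u∈X u≺v)

  reach-downClosed : ∀ {τ h} → Reach G τ h → DownClosed h
  reach-downClosed start           ()
  reach-downClosed (maker r _ L)   = downClosed-∷ʳ (reach-downClosed r) L
  reach-downClosed (breaker r _ L) = downClosed-∷ʳ (reach-downClosed r) L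

module Avoidance
  {V : Set} (_≟_ : DecidableEquality V) (G : Game V)
  (legal-or-complete : ∀ h → Σ V (Legal G h) ⊎ Complete G h)
  {x y : V} (x∈X : Board G x) (y∈X : Board G y) (y≺x : _≺_ G y x)
  (≺x⇒≼y : ∀ {u} → _≺_ G u x → u ≡ y ⊎ _≺_ G u y)
  (x-maximal : ∀ {u} → Board G u → ¬ _≺_ G x u)
  (≻y⇒≡x : ∀ {u} → Board G u → _≺_ G y u → u ≡ x)
  ([x]∈Win : Any (_⊆ x ∷ []) (Win G))
  (σ : Strategy V) (σ-wins : WinningStrategy G σ)
  where

  open DecMembership _≟_ using (_∈?_)

  x≢y : x ≢ y
  x≢y refl = x-maximal y∈X y≺x

  owns-if-x : ∀ {M} → x ∈ M → MakerOwnsWinSet G M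
  owns-if-x {M} x∈M = Any.map (λ S⊆[x] → All.tabulate (λ v∈S → from-[x] (S⊆[x] v∈S))) [x]∈Win
    where
    from-[x] : ∀ {v} → v ∈ x ∷ [] → v ∈ M
    from-[x] (here refl) = x∈M

  legal⇒incomplete : ∀ {h m} → Legal G h m → ¬ Complete G h
  legal⇒incomplete (m∈X , m∉h , _) complete = m∉h (complete _ m∈X)

  complete? : ∀ h → Dec (Complete G h)
  complete? h with legal-or-complete h
  ... | inj₁ (_ , L)  = no (legal⇒incomplete L)
  ... | inj₂ complete = yes complete

  anyMove : Strategy V
  anyMove h with legal-or-complete h
  ... | inj₁ (m , _) = m
  ... | inj₂ _       = x

  anyMove-legal : ∀ h → ¬ Complete G h → Legal G h (anyMove h)
  anyMove-legal h incomplete with legal-or-complete h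
  ... | inj₁ (_ , L)  = L
  ... | inj₂ complete = ⊥-elim (incomplete complete)

  Ready : List V → Set
  Ready a = length a % 2 ≡ 0 × σ a ≡ y × y ∉ a

  ready? : Decidable Ready
  ready? a = (length a % 2 ℕ.≟ 0) ×-dec ((σ a ≟ y) ×-dec ¬? (y ∈? a))

  bypassY : List V → List V
  bypassY a with ready? a
  ... | yes _ = a ∷ʳ y ∷ʳ x
  ... | no _  = a

  virtual : List V → List V
  virtual = foldl (λ a v → bypassY a ∷ʳ v) []

  virtual-∷ʳ : ∀ h v → virtual (h ∷ʳ v) ≡ bypassY (virtual h) ∷ʳ v
  virtual-∷ʳ h v = foldl-∷ʳ (λ a u → bypassY a ∷ʳ u) [] v h

  bypassY-odd : ∀ a → length a % 2 ≡ 1 → bypassY a ≡ a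
  bypassY-odd a od with ready? a
  ... | yes (ev , _) = ⊥-elim (even≢odd (length a) ev od)
  ... | no _         = refl

  avoider : Strategy V
  avoider h with x ∈? h | y ∈? h
  ... | yes _ | _     = anyMove h
  ... | no _  | yes _ = x
  ... | no _  | no _  with complete? (bypassY (virtual h))
  ...   | yes _ = y
  ...   | no _  = σ (bypassY (virtual h))

  record Tracks (h a : List V) : Set where
    field
      reach    : Reach G σ a
      sameTurn : length a % 2 ≡ length h % 2
      h⊆a      : h ⊆ a
      a⊆xyh    : a ⊆ x ∷ y ∷ h
      maker⊆   : makerPart a ⊆ y ∷ makerPart h
      y∈⇒x∈    : y ∈ a → x ∈ a

  data Phase (h : List V) : Set where
    shadowing : x ∉ h → y ∉ h → Tracks h (virtual h) → Phase h
    claimingX : y ∈ h → x ∉ h → length h % 2 ≡ 0 → Phase h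
    won       : MakerOwnsWinSet G (makerPart h) → x ∈ h ⊎ y ∈ h → Phase h

  GoodMove : List V → V → Set
  GoodMove h m = Legal G h m × Phase (h ∷ʳ m) × (m ≡ y → MakerOwnsWinSet G (makerPart h ∷ʳ y))

  tracks-[] : Tracks [] []
  tracks-[] = record
    { reach = start ; sameTurn = refl ; h⊆a = λ () ; a⊆xyh = λ () ; maker⊆ = λ () ; y∈⇒x∈ = λ () }

  claimX-legal : ∀ {h} → DownClosed {G = G} h → y ∈ h → x ∉ h → Legal G h x
  claimX-legal closed y∈h x∉h =
    x∈X , x∉h , λ u u∈X u≺x → [ (λ { refl → y∈h }) , closed y∈h u∈X ]′ (≺x⇒≼y u≺x)

  tracks-bypass : ∀ {h a} → Tracks h a → Ready a → Tracks h (a ∷ʳ y ∷ʳ x)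
  tracks-bypass {h} {a} tr (ev , σa≡y , y∉a) = record
    { reach    = breaker reach-y (even-∷ʳ a y ev)
                   (claimX-legal (reach-downClosed reach-y) (∈-∷ʳ-last a) x∉ay)
    ; sameTurn = trans (sameTurn-∷ʳ∷ʳ a y x) sameTurn
    ; h⊆a      = ∈-++⁺ˡ ∘ ∈-++⁺ˡ ∘ h⊆a
    ; a⊆xyh    = ∷ʳ-⊆ (∷ʳ-⊆ a⊆xyh (there (here refl))) (here refl)
    ; maker⊆   = ∷ʳ-⊆ maker⊆ (here refl) ∘ subst (_ ∈_) makerPart≡
    ; y∈⇒x∈    = λ _ → ∈-∷ʳ-last (a ∷ʳ y)
    }
    where
    open Tracks tr
    reach-y : Reach G σ (a ∷ʳ y)
    reach-y = subst (λ m → Reach G σ (a ∷ʳ m)) σa≡y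
                (maker reach ev (proj₁ σ-wins a reach ev (λ c → y∉a (c y y∈X))))
    x∉ay : x ∉ a ∷ʳ y
    x∉ay = ∉-∷ʳ (λ x∈a → y∉a (reach-downClosed reach x∈a y∈X y≺x)) x≢y
    makerPart≡ : makerPart (a ∷ʳ y ∷ʳ x) ≡ makerPart a ∷ʳ y
    makerPart≡ = trans (makerPart-∷ʳ-odd (a ∷ʳ y) x (even-∷ʳ a y ev)) (makerPart-∷ʳ-even a y ev)

  bypassY-tracks : ∀ {h a} → Tracks h a → length h % 2 ≡ 0 →
                   Tracks h (bypassY a) × (y ∈ bypassY a ⊎ σ (bypassY a) ≢ y)
  bypassY-tracks {h} {a} tr ev with ready? a
  ... | yes ready = tracks-bypass tr ready , inj₁ (∈-++⁺ˡ (∈-∷ʳ-last a))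
  ... | no ¬ready with y ∈? a
  ...   | yes y∈a = tr , inj₁ y∈a
  ...   | no y∉a  = tr , inj₂ (λ σa≡y → ¬ready (trans (Tracks.sameTurn tr) ev , σa≡y , y∉a))

  tracks-∷ʳ : ∀ {h a m} → Tracks h a → m ≢ y → Reach G σ (a ∷ʳ m) → Tracks (h ∷ʳ m) (a ∷ʳ m)
  tracks-∷ʳ {h} {a} {m} tr m≢y reach-m = record
    { reach    = reach-m
    ; sameTurn = sameTurn-∷ʳ a h m m sameTurn
    ; h⊆a      = ⊆.++⁺ˡ [ m ] h⊆a
    ; a⊆xyh    = ⊆.++⁺ˡ [ m ] a⊆xyh
    ; maker⊆   = maker⊆′ (even-or-odd (length h))
    ; y∈⇒x∈    = λ y∈ → [ ∈-++⁺ˡ ∘ y∈⇒x∈ , (λ y≡m → ⊥-elim (m≢y (sym y≡m))) ]′ (∈-∷ʳ⁻ a y∈)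
    }
    where
    open Tracks tr
    maker⊆′ : length h % 2 ≡ 0 ⊎ length h % 2 ≡ 1 → makerPart (a ∷ʳ m) ⊆ y ∷ makerPart (h ∷ʳ m)
    maker⊆′ (inj₁ ev) rewrite makerPart-∷ʳ-even a m (trans sameTurn ev) | makerPart-∷ʳ-even h m ev =
      ⊆.++⁺ˡ [ m ] maker⊆
    maker⊆′ (inj₂ od) rewrite makerPart-∷ʳ-odd a m (trans sameTurn od) | makerPart-∷ʳ-odd h m od =
      maker⊆

  lower-in-real : ∀ {h s m u} → Tracks h s → Board G m → m ≢ x → _≺_ G u m → u ∈ s → u ∈ h
  lower-in-real tr m∈X m≢x u≺m u∈s with Tracks.a⊆xyh tr u∈s
  ... | here refl         = ⊥-elim (x-maximal m∈X u≺m)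
  ... | there (here refl) = ⊥-elim (m≢x (≻y⇒≡x m∈X u≺m))
  ... | there (there u∈h) = u∈h

  won-∷ʳ : ∀ {h} v → MakerOwnsWinSet G (makerPart h) → x ∈ h ⊎ y ∈ h → Phase (h ∷ʳ v)
  won-∷ʳ {h} v owns x∨y =
    won (ownsWinSet-mono {G = G} (makerPart-⊆-∷ʳ h v) owns) (Data.Sum.map ∈-++⁺ˡ ∈-++⁺ˡ x∨y)

  won-good : ∀ {h m} → MakerOwnsWinSet G (makerPart h) → x ∈ h ⊎ y ∈ h → Legal G h m → GoodMove h m
  won-good owns x∨y L = L , won-∷ʳ _ owns x∨y , λ _ → ownsWinSet-mono {G = G} ∈-++⁺ˡ owns

  claimX-good : ∀ {h} → DownClosed {G = G} h → y ∈ h → x ∉ h → length h % 2 ≡ 0 → GoodMove h x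
  claimX-good {h} closed y∈h x∉h ev =
    claimX-legal closed y∈h x∉h ,
    won (subst (MakerOwnsWinSet G) (sym (makerPart-∷ʳ-even h x ev)) (owns-if-x (∈-∷ʳ-last _)))
        (inj₁ (∈-∷ʳ-last h)) ,
    ⊥-elim ∘ x≢y

  shadow-complete : ∀ {h s} → y ∉ h → length h % 2 ≡ 0 → Tracks h s → Complete G s → GoodMove h y
  shadow-complete {h} {s} y∉h ev tr complete = legal-y , won owns′ (inj₂ (∈-∷ʳ-last h)) , λ _ → owns
    where
    open Tracks tr
    legal-y : Legal G h y
    legal-y = y∈X , y∉h , λ u u∈X u≺y → lower-in-real tr y∈X (x≢y ∘ sym) u≺y (complete u u∈X)
    owns : MakerOwnsWinSet G (makerPart h ∷ʳ y)
    owns = ownsWinSet-mono {G = G} (∷⊆∷ʳ (makerPart h) ∘ maker⊆) (proj₂ σ-wins s reach complete)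
    owns′ : MakerOwnsWinSet G (makerPart (h ∷ʳ y))
    owns′ = subst (MakerOwnsWinSet G) (sym (makerPart-∷ʳ-even h y ev)) owns

  shadow-continue : ∀ {h} → x ∉ h → y ∉ h → length h % 2 ≡ 0 →
    let s = bypassY (virtual h) in
    Tracks h s → y ∈ s ⊎ σ s ≢ y → ¬ Complete G s → GoodMove h (σ s)
  shadow-continue {h} x∉h y∉h ev tr y-ok incomplete =
    legal ,
    shadowing (∉-∷ʳ x∉h (m≢x ∘ sym)) (∉-∷ʳ y∉h (m≢y ∘ sym)) tracks′ ,
    ⊥-elim ∘ m≢y
    where
    open Tracks tr
    s : List V
    s = bypassY (virtual h)
    m : V
    m = σ s
    L : Legal G s m
    L = proj₁ σ-wins s reach (trans sameTurn ev) incomplete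
    m∈X : Board G m
    m∈X = proj₁ L
    m∉s : m ∉ s
    m∉s = proj₁ (proj₂ L)
    below : ∀ u → Board G u → _≺_ G u m → u ∈ s
    below = proj₂ (proj₂ L)
    m≢y : m ≢ y
    m≢y m≡y = [ (λ y∈s → m∉s (subst (_∈ s) (sym m≡y) y∈s)) , (λ σs≢y → σs≢y m≡y) ]′ y-ok
    m≢x : m ≢ x
    m≢x m≡x = m∉s (subst (_∈ s) (sym m≡x) (y∈⇒x∈ (below y y∈X (subst (_≺_ G y) (sym m≡x) y≺x))))
    legal : Legal G h m
    legal = m∈X , m∉s ∘ h⊆a , λ u u∈X u≺m → lower-in-real tr m∈X m≢x u≺m (below u u∈X u≺m)
    tracks′ : Tracks (h ∷ʳ m) (virtual (h ∷ʳ m))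
    tracks′ = subst (Tracks (h ∷ʳ m)) (sym (virtual-∷ʳ h m))
                (tracks-∷ʳ tr m≢y (maker reach (trans sameTurn ev) L))

  shadow-breaker : ∀ {h v} → x ∉ h → y ∉ h → Tracks h (virtual h) → length h % 2 ≡ 1 →
                   Legal G h v → Phase (h ∷ʳ v)
  shadow-breaker {h} {v} x∉h y∉h tr od (v∈X , v∉h , below) with v ≟ y | v ≟ x
  ... | yes refl | _        = claimingX (∈-∷ʳ-last h) (∉-∷ʳ x∉h x≢y) (odd-∷ʳ h y od)
  ... | no _     | yes refl = ⊥-elim (y∉h (below y y∈X y≺x))
  ... | no v≢y   | no v≢x   =
    shadowing (∉-∷ʳ x∉h (v≢x ∘ sym)) (∉-∷ʳ y∉h (v≢y ∘ sym)) tracks′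
    where
    open Tracks tr
    a : List V
    a = virtual h
    od-a : length a % 2 ≡ 1
    od-a = trans sameTurn od
    v∉a : v ∉ a
    v∉a v∈a with a⊆xyh v∈a
    ... | here v≡x          = v≢x v≡x
    ... | there (here v≡y)  = v≢y v≡y
    ... | there (there v∈h) = v∉h v∈h
    legal : Legal G a v
    legal = v∈X , v∉a , λ u u∈X u≺v → h⊆a (below u u∈X u≺v)
    tracks′ : Tracks (h ∷ʳ v) (virtual (h ∷ʳ v))
    virtual≡ : virtual (h ∷ʳ v) ≡ a ∷ʳ v
    virtual≡ = trans (virtual-∷ʳ h v) (cong (_∷ʳ v) (bypassY-odd a od-a))
    tracks′ = subst (Tracks (h ∷ʳ v)) (sym virtual≡) (tracks-∷ʳ tr v≢y (breaker reach od-a legal))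

  maker-step : ∀ {h} → Reach G avoider h → Phase h → length h % 2 ≡ 0 → ¬ Complete G h →
               GoodMove h (avoider h)
  maker-step {h} r ph ev incomplete with x ∈? h | y ∈? h | ph
  ... | yes _   | _       | won owns x∨y     = won-good owns x∨y (anyMove-legal h incomplete)
  ... | yes x∈h | _       | shadowing x∉h _ _ = ⊥-elim (x∉h x∈h)
  ... | yes x∈h | _       | claimingX _ x∉h _ = ⊥-elim (x∉h x∈h)
  ... | no x∉h  | yes y∈h | won owns x∨y      =
    won-good owns x∨y (claimX-legal (reach-downClosed r) y∈h x∉h)
  ... | no x∉h  | yes y∈h | claimingX _ _ _   = claimX-good (reach-downClosed r) y∈h x∉h ev
  ... | no _    | yes y∈h | shadowing _ y∉h _ = ⊥-elim (y∉h y∈h)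
  ... | no x∉h  | no y∉h  | won _ x∨y         = ⊥-elim ([ x∉h , y∉h ]′ x∨y)
  ... | no _    | no y∉h  | claimingX y∈h _ _ = ⊥-elim (y∉h y∈h)
  ... | no x∉h  | no y∉h  | shadowing _ _ tr
    with bypassY-tracks tr ev | complete? (bypassY (virtual h))
  ...   | tr′ , _    | yes complete   = shadow-complete y∉h ev tr′ complete
  ...   | tr′ , y-ok | no incomplete′ = shadow-continue x∉h y∉h ev tr′ y-ok incomplete′

  breaker-step : ∀ {h v} → Phase h → length h % 2 ≡ 1 → Legal G h v → Phase (h ∷ʳ v)
  breaker-step (shadowing x∉h y∉h tr) od L = shadow-breaker x∉h y∉h tr od L
  breaker-step {h} (claimingX _ _ ev) od _ = ⊥-elim (even≢odd (length h) ev od)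
  breaker-step (won owns x∨y)         _  _ = won-∷ʳ _ owns x∨y

  phase : ∀ {h} → Reach G avoider h → Phase h
  phase start             = shadowing (λ ()) (λ ()) tracks-[]
  phase (maker r ev L)    = proj₁ (proj₂ (maker-step r (phase r) ev (legal⇒incomplete L)))
  phase (breaker r od L)  = breaker-step (phase r) od L

  avoider-wins : WinningStrategy G avoider
  avoider-wins = (λ h r ev incomplete → proj₁ (maker-step r (phase r) ev incomplete)) , wins
    where
    wins : ∀ h → Reach G avoider h → Complete G h → MakerWon G h
    wins h r complete with phase r
    ... | shadowing x∉h _ _ = ⊥-elim (x∉h (complete x x∈X))
    ... | claimingX _ x∉h _ = ⊥-elim (x∉h (complete x x∈X))
    ... | won owns _        = owns

  avoider-avoidsY : NeverClaimsUnlessWin G avoider y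
  avoider-avoidsY h r ev incomplete = proj₂ (proj₂ (maker-step r (phase r) ev incomplete))

_≟ⱽ_ : ∀ {w} → DecidableEquality (Vtx w)
_≟ⱽ_ = ≡-dec Fin._≟_ ℕ._≟_

module ChainSubgame {w : ℕ} (ℓ : Fin w → ℕ) (Keep : Vtx w → Set) (keep? : Decidable Keep)
                    (W : List (List (Vtx w))) where

  open Chains ℓ
  open DecMembership (_≟ⱽ_ {w}) using (_∈?_)

  game : Game (Vtx w)
  game = record
    { Board = λ v → OnX v × Keep v
    ; _≺_   = λ u v → (OnX u × Keep u) × (OnX v × Keep v) × u <P v
    ; Win   = W
    }

  Settled : List (Vtx w) → Vtx w → Set
  Settled h v = ¬ Keep v ⊎ v ∈ h

  settled-kept : ∀ {h v} → Settled h v → Keep v → v ∈ h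
  settled-kept (inj₁ ¬keep) keep = ⊥-elim (¬keep keep)
  settled-kept (inj₂ taken) _    = taken

  SettledBelow : List (Vtx w) → Fin w → ℕ → Set
  SettledBelow h k n = ∀ {j} → n < j → j ≤ ℓ k → Settled h (k , j)

  settledBelow-pred : ∀ {h k n} → Settled h (k , suc n) → SettledBelow h k (suc n) →
                      SettledBelow h k n
  settledBelow-pred settled below n<j j≤ℓ with m≤n⇒m<n∨m≡n n<j
  ... | inj₁ sn<j = below sn<j j≤ℓ
  ... | inj₂ refl = settled

  scan : ∀ h k n → n ≤ ℓ k → SettledBelow h k n →
         Σ ℕ (λ j → Legal game h (k , j)) ⊎ SettledBelow h k 0
  scan h k zero    _   below = inj₂ below
  scan h k (suc n) n≤ℓ below with keep? (k , suc n) | (k , suc n) ∈? h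
  ... | no ¬keep | _         = scan h k n (≤-trans (n≤1+n n) n≤ℓ) (settledBelow-pred (inj₁ ¬keep) below)
  ... | yes _    | yes taken = scan h k n (≤-trans (n≤1+n n) n≤ℓ) (settledBelow-pred (inj₂ taken) below)
  ... | yes keep | no free   = inj₁ (suc n , ((s≤s z≤n , n≤ℓ) , keep) , free , lower-taken)
    where
    lower-taken : ∀ u → Board game u → _≺_ game u (k , suc n) → u ∈ h
    lower-taken (_ , j) ((_ , j≤ℓ) , keep-u) (_ , _ , refl , n<j) =
      settled-kept (below n<j j≤ℓ) keep-u

  legal-or-settled : ∀ h k → Σ ℕ (λ j → Legal game h (k , j)) ⊎ SettledBelow h k 0
  legal-or-settled h k = scan h k (ℓ k) ≤-refl (λ ℓ<j j≤ℓ → ⊥-elim (<⇒≱ ℓ<j j≤ℓ))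

  settled⇒taken : ∀ {h k j} → SettledBelow h k 0 → Board game (k , j) → (k , j) ∈ h
  settled⇒taken settled ((0<j , j≤ℓ) , keep) = settled-kept (settled 0<j j≤ℓ) keep

  legal-in? : ∀ h k → Dec (Σ ℕ (λ j → Legal game h (k , j)))
  legal-in? h k with legal-or-settled h k
  ... | inj₁ L       = yes L
  ... | inj₂ settled = no (λ { (_ , v∈X , v∉h , _) → v∉h (settled⇒taken settled v∈X) })

  legal-or-complete : ∀ h → Σ (Vtx w) (Legal game h) ⊎ Complete game h
  legal-or-complete h with any? (legal-in? h)
  ... | yes (k , j , L) = inj₁ ((k , j) , L)
  ... | no ¬legal       = inj₂ complete
    where
    complete : Complete game h
    complete (k , j) v∈X with legal-or-settled h k
    ... | inj₁ L       = ⊥-elim (¬legal (k , L))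
    ... | inj₂ settled = settled⇒taken settled v∈X

module ReducedChains {w : ℕ} (ℓ : Fin w → ℕ) (F : List (List (Vtx w))) (i : Fin w) (j : ℕ)
                     (x∈X : Chains.OnX ℓ (i , j)) (y∈X : Chains.OnX ℓ (i , suc j)) where

  open Chains ℓ
  open Reduced F i j

  x∈X' : OnX' (i , j)
  x∈X' = x∈X , λ (_ , _ , j<j) → <-irrefl refl j<j

  y∈X' : OnX' (i , suc j)
  y∈X' = y∈X , λ (_ , _ , sj<j) → <-irrefl refl (≤-trans (n≤1+n (suc j)) sj<j)

  y≺x : (i , suc j) <P' (i , j)
  y≺x = y∈X' , x∈X' , refl , ≤-refl

  ≺x⇒≼y : ∀ {u} → u <P' (i , j) → u ≡ (i , suc j) ⊎ u <P' (i , suc j)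
  ≺x⇒≼y (u∈X' , _ , refl , j<k) with m≤n⇒m<n∨m≡n j<k
  ... | inj₁ sj<k = inj₂ (u∈X' , y∈X' , refl , sj<k)
  ... | inj₂ refl = inj₁ refl

  x-maximal : ∀ {u} → OnX' u → ¬ (i , j) <P' u
  x-maximal ((1≤k , _) , ∉Y) (_ , _ , refl , k<j) = ∉Y (refl , 1≤k , k<j)

  ≻y⇒≡x : ∀ {u} → OnX' u → (i , suc j) <P' u → u ≡ (i , j)
  ≻y⇒≡x ((1≤k , _) , ∉Y) (_ , _ , refl , k<sj) with m<1+n⇒m<n∨m≡n k<sj
  ... | inj₁ k<j  = ⊥-elim (∉Y (refl , 1≤k , k<j))
  ... | inj₂ refl = refl

  [x]∈F' : Any (λ S → SameSet S ((i , j) ∷ [])) F → Any (_⊆ (i , j) ∷ []) F'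
  [x]∈F' [x]∈F with find [x]∈F
  ... | S , S∈F , S⊆[x] , _ = ++⁺ˡ (lose (∈-filter⁺ _ S∈F (All.tabulate outsideY)) (S⊆[x] _))
    where
    outsideY : ∀ {v} → v ∈ S → ¬ InY v
    outsideY v∈S with S⊆[x] _ v∈S
    ... | here refl = proj₂ x∈X'

  legal-or-complete′ : ∀ h → Σ (Vtx w) (Legal G' h) ⊎ Complete G' h
  legal-or-complete′ = ChainSubgame.legal-or-complete ℓ (λ v → ¬ InY v) (λ v → ¬? (inY? v)) F'

nonMinimal⇒successor : ∀ {w} (ℓ : Fin w → ℕ) F {i j} →
                       ¬ IsMinimal (Chains.chainGame ℓ F) (i , j) → suc j ≤ ℓ i
nonMinimal⇒successor ℓ F {i} {j} ¬minimal with suc j ≤? ℓ i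
... | yes sj≤ℓ = sj≤ℓ
... | no sj≰ℓ  = ⊥-elim (¬minimal λ { (_ , k) (_ , k≤ℓ) (refl , j<k) → sj≰ℓ (≤-trans j<k k≤ℓ) })

lemma5 : (w : ℕ) (ℓ : Fin w → ℕ) (F : List (List (Vtx w))) →
    All (All (Chains.OnX ℓ)) F →
    (i : Fin w) (j : ℕ) →
    3 ≤ j →
    Chains.OnX ℓ (i , j) →
    Chains.Black ℓ (i , j) →
    ¬ IsMinimal (Chains.chainGame ℓ F) (i , j) →
    Any (λ S → SameSet S ((i , j) ∷ [])) F →
    Chains.size ℓ % 2 ≡ 0 →
    MakerWins (Chains.Reduced.G' ℓ F i j) →
    Σ (Strategy (Vtx w)) (λ σ →
      WinningStrategy (Chains.Reduced.G' ℓ F i j) σ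
      × NeverClaimsUnlessWin (Chains.Reduced.G' ℓ F i j) σ (i , suc j))
lemma5 w ℓ F _ i j _ x∈X _ ¬minimal [x]∈F _ (σ , σ-wins) = avoider , avoider-wins , avoider-avoidsY
  where
  y∈X : Chains.OnX ℓ (i , suc j)
  y∈X = s≤s z≤n , nonMinimal⇒successor ℓ F ¬minimal
  open ReducedChains ℓ F i j x∈X y∈X
  open Avoidance _≟ⱽ_ (Chains.Reduced.G' ℓ F i j) legal-or-complete′
    x∈X' y∈X' y≺x ≺x⇒≼y x-maximal ≻y⇒≡x ([x]∈F' [x]∈F) σ σ-wins
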